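{- Let $n$ be a positive integer. Any balancedly splittable Hadamard matrix of order $4n^2$ with parameters $(4n^2,2n^2-n,n,-n)$ is equivalent to a regular Hadamard matrix.
   Context: A Hadamard matrix of order $N$ is an $N\times N$ $\{1,-1\}$-matrix $H$ with $HH^\top=NI_N$; $J_N$ is the all-ones matrix. $H$ is balancedly splittable with parameters $(N,\ell,a,b)$ if, after permuting its rows, $H=\begin{pmatrix}H_1\\H_2\end{pmatrix}$ with $H_1$ an $\ell\times N$ matrix such that $H_1^\top H_1=\ell I_N+aA+b(J_N-A-I_N)$ for a symmetric $(0,1)$-matrix $A$ with zero diagonal. Two Hadamard matrices are equivalent if one is obtained from the other by permuting rows and columns and multiplying rows and columns by $-1$. A Hadamard matrix $H$ of order $N$ is regular if $\mathbf{1}^\top H=\sqrt N\,\mathbf{1}^\top$, where $\mathbf 1$ is the all-ones column vector. -}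

module Defs where

open import Data.Nat as ℕ using (ℕ; zero; suc)
open import Data.Integer using (ℤ; +_; -_; _+_; _*_; _-_; 0ℤ; 1ℤ; -1ℤ)
open import Data.Fin using (Fin; zero; suc; inject≤)
open import Data.Fin.Permutation using (Permutation′; _⟨$⟩ʳ_)
open import Data.Product using (Σ; _×_; _,_)
open import Data.Sum using (_⊎_)
open import Relation.Binary.PropositionalEquality using (_≡_; _≢_)

Mat : ℕ → ℕ → Set
Mat m n = Fin m → Fin n → ℤ

sumℤ : (n : ℕ) → (Fin n → ℤ) → ℤ
sumℤ zero    f = 0ℤ
sumℤ (suc n) f = f zero + sumℤ n (λ i → f (suc i))

_ᵀ : ∀ {m n} → Mat m n → Mat n m
(M ᵀ) i j = M j i

_⊗_ : ∀ {m k n} → Mat m k → Mat k n → Mat m n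
_⊗_ {k = k} A B i j = sumℤ k (λ t → A i t * B t j)

δ : ∀ {n} → Fin n → Fin n → ℤ
δ zero    zero    = 1ℤ
δ zero    (suc j) = 0ℤ
δ (suc i) zero    = 0ℤ
δ (suc i) (suc j) = δ i j

I : (n : ℕ) → Mat n n
I n = δ

J : (n : ℕ) → Mat n n
J n i j = 1ℤ

IsPM1 : ℤ → Set
IsPM1 x = (x ≡ 1ℤ) ⊎ (x ≡ -1ℤ)

IsHadamard : (N : ℕ) → Mat N N → Set
IsHadamard N H =
  (∀ i j → IsPM1 (H i j)) ×
  (∀ i j → (H ⊗ (H ᵀ)) i j ≡ (+ N) * I N i j)

IsAdj : (N : ℕ) → Mat N N → Set
IsAdj N A =
  (∀ i j → (A i j ≡ 0ℤ) ⊎ (A i j ≡ 1ℤ)) ×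
  (∀ i j → A i j ≡ A j i) ×
  (∀ i → A i i ≡ 0ℤ)

BalancedlySplittable : (N ℓ : ℕ) (a b : ℤ) → Mat N N → Set
BalancedlySplittable N ℓ a b H =
  Σ (ℓ ℕ.≤ N) λ ℓ≤N →
  Σ (Permutation′ N) λ σ →
  Σ (Mat N N) λ A →
    IsAdj N A ×
    (let H₁ : Mat ℓ N
         H₁ i j = H (σ ⟨$⟩ʳ inject≤ i ℓ≤N) j
     in ∀ i j → ((H₁ ᵀ) ⊗ H₁) i j
                ≡ (+ ℓ) * I N i j + a * A i j
                  + b * (J N i j - A i j - I N i j))

Equivalent : (N : ℕ) → Mat N N → Mat N N → Set
Equivalent N H H' =
  Σ (Permutation′ N) λ P →
  Σ (Permutation′ N) λ Q →
  Σ (Fin N → ℤ) λ r →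
  Σ (Fin N → ℤ) λ c →
    (∀ i → IsPM1 (r i)) × (∀ j → IsPM1 (c j)) ×
    (∀ i j → H' i j ≡ r i * c j * H (P ⟨$⟩ʳ i) (Q ⟨$⟩ʳ j))

IsRegular : (N : ℕ) → Mat N N → Set
IsRegular N H =
  Σ ℕ λ s → (s ℕ.* s ≡ N) × (∀ j → sumℤ N (λ i → H i j) ≡ + s)

module Submission where

-- Let H₁ (ℓ rows, ℓ = 2n²−n) be the split part and ε the row-sign vector
-- that is −1 on the rows of H₁ and +1 elsewhere.  Since Hᵀ H = N I,
--     Σᵢ εᵢ Hᵢₖ Hᵢⱼ = (HᵀH)ₖⱼ − 2 (H₁ᵀH₁)ₖⱼ = 2n (1 − 2Aₖⱼ)   (for the given parameters),
-- so with xᵢ = εᵢ Hᵢₖ and zⱼ = 1 − 2Aⱼₖ (both ±1) the rescaled matrix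
-- H'ᵢⱼ = xᵢ zⱼ Hᵢⱼ has every column sum equal to 2n = √N.

open import Defs
open import Data.Nat using (ℕ; _*_; _∸_; NonZero)
open import Data.Integer using (+_; -_)
open import Data.Product using (Σ; _×_)

open import Data.Nat as ℕ using (zero; suc; z≤n; s≤s)
import Data.Nat.Properties as ℕP
import Data.Nat.Tactic.RingSolver as ℕRing
open import Data.Integer using (ℤ; 0ℤ; 1ℤ; _+_; _-_; _≤_; +≤+; -[1+_]; _⊖_)
  renaming (_*_ to _·_)
import Data.Integer.Properties as ℤP
open import Data.Integer.Tactic.RingSolver using (solve-∀)
open import Data.Fin using (Fin; zero; suc; toℕ; inject≤)
open import Data.Fin.Permutation as Perm using (Permutation′; _⟨$⟩ʳ_; _⟨$⟩ˡ_)
open import Data.Product using (_,_; proj₁; proj₂)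
open import Data.Sum using (_⊎_; inj₁; inj₂)
open import Relation.Binary.PropositionalEquality
  using (_≡_; refl; sym; trans; cong; cong₂; subst; module ≡-Reasoning)
import Algebra.Properties.Semiring.Sum ℤP.+-*-semiring as LibSum

open ≡-Reasoning

∑-syntax : ∀ n → (Fin n → ℤ) → ℤ
∑-syntax = sumℤ

infixl 10 ∑-syntax
syntax ∑-syntax n (λ i → e) = ∑[ i < n ] e

-- 1. Finite sums

sumℤ≡sum : ∀ n (f : Fin n → ℤ) → sumℤ n f ≡ LibSum.sum f
sumℤ≡sum zero    f = refl
sumℤ≡sum (suc n) f = cong (_+_ (f zero)) (sumℤ≡sum n (λ i → f (suc i)))

sum-cong : ∀ n {f g : Fin n → ℤ} → (∀ i → f i ≡ g i) → sumℤ n f ≡ sumℤ n g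
sum-cong n {f} {g} f≗g = begin
  sumℤ n f      ≡⟨ sumℤ≡sum n f ⟩
  LibSum.sum f  ≡⟨ LibSum.sum-cong-≗ f≗g ⟩
  LibSum.sum g  ≡⟨ sumℤ≡sum n g ⟨
  sumℤ n g      ∎

sum-+ : ∀ n (f g : Fin n → ℤ) → ∑[ i < n ] (f i + g i) ≡ sumℤ n f + sumℤ n g
sum-+ n f g = begin
  ∑[ i < n ] (f i + g i)            ≡⟨ sumℤ≡sum n _ ⟩
  LibSum.sum (λ i → f i + g i)      ≡⟨ LibSum.∑-distrib-+ f g ⟩
  LibSum.sum f + LibSum.sum g       ≡⟨ cong₂ _+_ (sumℤ≡sum n f) (sumℤ≡sum n g) ⟨
  sumℤ n f + sumℤ n g               ∎

sum-scale : ∀ n c (f : Fin n → ℤ) → ∑[ i < n ] (c · f i) ≡ c · sumℤ n f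
sum-scale n c f = begin
  ∑[ i < n ] (c · f i)        ≡⟨ sumℤ≡sum n _ ⟩
  LibSum.sum (λ i → c · f i)  ≡⟨ LibSum.*-distribˡ-sum c f ⟨
  c · LibSum.sum f            ≡⟨ cong (c ·_) (sumℤ≡sum n f) ⟨
  c · sumℤ n f                ∎

sum-swap : ∀ m n (f : Fin m → Fin n → ℤ) →
           ∑[ i < m ] ∑[ j < n ] f i j ≡ ∑[ j < n ] ∑[ i < m ] f i j
sum-swap m n f = begin
  ∑[ i < m ] ∑[ j < n ] f i j                 ≡⟨ sum-cong m (λ i → sumℤ≡sum n (f i)) ⟩
  ∑[ i < m ] LibSum.sum (f i)                 ≡⟨ sumℤ≡sum m _ ⟩
  LibSum.sum (λ i → LibSum.sum (f i))         ≡⟨ LibSum.∑-comm f ⟩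
  LibSum.sum (λ j → LibSum.sum (λ i → f i j)) ≡⟨ sumℤ≡sum n _ ⟨
  ∑[ j < n ] LibSum.sum (λ i → f i j)         ≡⟨ sum-cong n (λ j → sumℤ≡sum m _) ⟨
  ∑[ j < n ] ∑[ i < m ] f i j                 ∎

sum-permute : ∀ n (σ : Permutation′ n) (f : Fin n → ℤ) →
              sumℤ n f ≡ ∑[ i < n ] f (σ ⟨$⟩ʳ i)
sum-permute n σ f = begin
  sumℤ n f                          ≡⟨ sumℤ≡sum n f ⟩
  LibSum.sum f                      ≡⟨ LibSum.∑-permute f σ ⟩
  LibSum.sum (λ i → f (σ ⟨$⟩ʳ i))   ≡⟨ sumℤ≡sum n _ ⟨
  ∑[ i < n ] f (σ ⟨$⟩ʳ i)           ∎

sum-const : ∀ n c → ∑[ i < n ] c ≡ + n · c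
sum-const zero    c = sym (ℤP.*-zeroˡ c)
sum-const (suc n) c = begin
  c + ∑[ i < n ] c     ≡⟨ cong (_+_ c) (sum-const n c) ⟩
  c + + n · c          ≡⟨ cong (_+ + n · c) (ℤP.*-identityˡ c) ⟨
  1ℤ · c + + n · c     ≡⟨ ℤP.*-distribʳ-+ c 1ℤ (+ n) ⟨
  + suc n · c          ∎

sum-of-zeros : ∀ n {f : Fin n → ℤ} → (∀ i → f i ≡ 0ℤ) → sumℤ n f ≡ 0ℤ
sum-of-zeros n f≗0 = trans (sum-cong n f≗0) (trans (sum-const n 0ℤ) (ℤP.*-zeroʳ (+ n)))

sum-affine : ∀ n (f g h : Fin n → ℤ) a b →
  ∑[ i < n ] (f i + a · g i + b · h i) ≡ sumℤ n f + a · sumℤ n g + b · sumℤ n h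
sum-affine n f g h a b = begin
  ∑[ i < n ] (f i + a · g i + b · h i)
    ≡⟨ sum-+ n _ _ ⟩
  ∑[ i < n ] (f i + a · g i) + ∑[ i < n ] (b · h i)
    ≡⟨ cong₂ _+_ (sum-+ n _ _) (sum-scale n b h) ⟩
  sumℤ n f + ∑[ i < n ] (a · g i) + b · sumℤ n h
    ≡⟨ cong (λ s → sumℤ n f + s + b · sumℤ n h) (sum-scale n a g) ⟩
  sumℤ n f + a · sumℤ n g + b · sumℤ n h ∎

sum-product : ∀ m n (f : Fin m → ℤ) (g : Fin n → ℤ) →
              sumℤ m f · sumℤ n g ≡ ∑[ i < m ] ∑[ j < n ] (f i · g j)
sum-product m n f g = begin
  sumℤ m f · sumℤ n g               ≡⟨ ℤP.*-comm (sumℤ m f) _ ⟩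
  sumℤ n g · sumℤ m f               ≡⟨ sum-scale m (sumℤ n g) f ⟨
  ∑[ i < m ] (sumℤ n g · f i)       ≡⟨ sum-cong m (λ i → ℤP.*-comm (sumℤ n g) (f i)) ⟩
  ∑[ i < m ] (f i · sumℤ n g)       ≡⟨ sum-cong m (λ i → sum-scale n (f i) g) ⟨
  ∑[ i < m ] ∑[ j < n ] (f i · g j) ∎

sum-interchange : ∀ m n (F : Fin m → Fin m → Fin n → Fin n → ℤ) →
  ∑[ i < m ] ∑[ j < m ] ∑[ a < n ] ∑[ b < n ] F i j a b
    ≡ ∑[ a < n ] ∑[ b < n ] ∑[ i < m ] ∑[ j < m ] F i j a b
sum-interchange m n F = begin
  ∑[ i < m ] ∑[ j < m ] ∑[ a < n ] ∑[ b < n ] F i j a b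
    ≡⟨ sum-cong m (λ i → sum-swap m n (λ j a → ∑[ b < n ] F i j a b)) ⟩
  ∑[ i < m ] ∑[ a < n ] ∑[ j < m ] ∑[ b < n ] F i j a b
    ≡⟨ sum-swap m n (λ i a → ∑[ j < m ] ∑[ b < n ] F i j a b) ⟩
  ∑[ a < n ] ∑[ i < m ] ∑[ j < m ] ∑[ b < n ] F i j a b
    ≡⟨ sum-cong n (λ a → sum-cong m (λ i → sum-swap m n (λ j b → F i j a b))) ⟩
  ∑[ a < n ] ∑[ i < m ] ∑[ b < n ] ∑[ j < m ] F i j a b
    ≡⟨ sum-cong n (λ a → sum-swap m n (λ i b → ∑[ j < m ] F i j a b)) ⟩
  ∑[ a < n ] ∑[ b < n ] ∑[ i < m ] ∑[ j < m ] F i j a b ∎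

δ-refl : ∀ {n} (i : Fin n) → δ i i ≡ 1ℤ
δ-refl zero    = refl
δ-refl (suc i) = δ-refl i

δ-diag : ∀ {n} (f : Fin n → ℤ) i j → f i · δ i j ≡ f j · δ i j
δ-diag f zero    zero    = refl
δ-diag f zero    (suc j) = trans (ℤP.*-zeroʳ (f zero)) (sym (ℤP.*-zeroʳ (f (suc j))))
δ-diag f (suc i) zero    = trans (ℤP.*-zeroʳ (f (suc i))) (sym (ℤP.*-zeroʳ (f zero)))
δ-diag f (suc i) (suc j) = δ-diag (λ k → f (suc k)) i j

sum-δ : ∀ n (i : Fin n) (f : Fin n → ℤ) → ∑[ j < n ] (δ i j · f j) ≡ f i
sum-δ (suc n) zero f = begin
  1ℤ · f zero + ∑[ j < n ] (0ℤ · f (suc j)) ≡⟨ cong (_+_ (1ℤ · f zero)) (sum-of-zeros n (λ _ → refl)) ⟩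
  1ℤ · f zero + 0ℤ                          ≡⟨ ℤP.+-identityʳ _ ⟩
  1ℤ · f zero                               ≡⟨ ℤP.*-identityˡ (f zero) ⟩
  f zero                                    ∎
sum-δ (suc n) (suc i) f = trans (ℤP.+-identityˡ _) (sum-δ n i (λ j → f (suc j)))

sum-nonneg : ∀ n (f : Fin n → ℤ) → (∀ i → 0ℤ ≤ f i) → 0ℤ ≤ sumℤ n f
sum-nonneg zero    f f≥0 = +≤+ z≤n
sum-nonneg (suc n) f f≥0 = ℤP.+-mono-≤ (f≥0 zero) (sum-nonneg n _ (λ i → f≥0 (suc i)))

summand-zero : ∀ {a b} → 0ℤ ≤ a → 0ℤ ≤ b → a + b ≡ 0ℤ → a ≡ 0ℤ
summand-zero {a} {b} a≥0 b≥0 a+b≡0 = ℤP.≤-antisym a≤0 a≥0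
  where
  a≤0 : a ≤ 0ℤ
  a≤0 = ℤP.≤-trans (ℤP.≤-reflexive (sym (ℤP.+-identityʳ a)))
          (ℤP.≤-trans (ℤP.+-monoʳ-≤ a b≥0) (ℤP.≤-reflexive a+b≡0))

sum-zero⇒zero : ∀ n (f : Fin n → ℤ) → (∀ i → 0ℤ ≤ f i) → sumℤ n f ≡ 0ℤ → ∀ i → f i ≡ 0ℤ
sum-zero⇒zero (suc n) f f≥0 Σf≡0 zero = summand-zero (f≥0 zero) (sum-nonneg n _ (λ i → f≥0 (suc i))) Σf≡0
sum-zero⇒zero (suc n) f f≥0 Σf≡0 (suc i) =
  sum-zero⇒zero n (λ j → f (suc j)) (λ j → f≥0 (suc j)) tail-zero i
  where
  tail-zero : ∑[ j < n ] f (suc j) ≡ 0ℤ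
  tail-zero = summand-zero (sum-nonneg n _ (λ j → f≥0 (suc j))) (f≥0 zero)
                (trans (ℤP.+-comm _ (f zero)) Σf≡0)

square-nonneg : ∀ a → 0ℤ ≤ a · a
square-nonneg (+ n)      = subst (0ℤ ≤_) (ℤP.pos-* n n) (+≤+ z≤n)
square-nonneg -[1+ n ]    = +≤+ z≤n

square-zero : ∀ a → a · a ≡ 0ℤ → a ≡ 0ℤ
square-zero a a²≡0 with ℤP.i*j≡0⇒i≡0∨j≡0 a a²≡0
... | inj₁ a≡0 = a≡0
... | inj₂ a≡0 = a≡0

-- 2. H Hᵀ = cI implies Hᵀ H = cI for square integer matrices

sqNorm : ∀ n → Mat n n → ℤ
sqNorm n X = ∑[ i < n ] ∑[ j < n ] (X i j · X i j)

trace : ∀ n → Mat n n → ℤ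
trace n X = ∑[ i < n ] X i i

subScalar : ∀ {n} → ℤ → Mat n n → Mat n n
subScalar c X i j = X i j - c · δ i j

sqNorm-zero : ∀ n (X : Mat n n) → sqNorm n X ≡ 0ℤ → ∀ i j → X i j ≡ 0ℤ
sqNorm-zero n X ‖X‖²≡0 i j = square-zero (X i j) (sum-zero⇒zero n _ (λ j → square-nonneg (X i j)) row-zero j)
  where
  row-zero : ∑[ j < n ] (X i j · X i j) ≡ 0ℤ
  row-zero = sum-zero⇒zero n _ (λ i → sum-nonneg n _ (λ j → square-nonneg (X i j))) ‖X‖²≡0 i

-- ‖X − cI‖² = ‖X‖² − 2c tr X + c² n: it depends on X only through ‖X‖² and tr X.
sqNorm-subScalar : ∀ n c (X : Mat n n) →
  sqNorm n (subScalar c X) ≡ sqNorm n X + (- (+ 2 · c)) · trace n X + (c · c) · + n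
sqNorm-subScalar n c X = begin
  sqNorm n (subScalar c X)
    ≡⟨ sum-cong n (λ i → sum-cong n (λ j → expand c (X i j) (δ i j))) ⟩
  ∑[ i < n ] ∑[ j < n ] (X i j · X i j + u · (δ i j · X i j) + v · (δ i j · δ i j))
    ≡⟨ sum-cong n (λ i → sum-affine n _ _ _ u v) ⟩
  ∑[ i < n ] (∑[ j < n ] (X i j · X i j) + u · ∑[ j < n ] (δ i j · X i j) + v · ∑[ j < n ] (δ i j · δ i j))
    ≡⟨ sum-affine n _ _ _ u v ⟩
  sqNorm n X + u · ∑[ i < n ] ∑[ j < n ] (δ i j · X i j) + v · ∑[ i < n ] ∑[ j < n ] (δ i j · δ i j)
    ≡⟨ cong₂ (λ s t → sqNorm n X + u · s + v · t) (sum-cong n (λ i → sum-δ n i (X i))) diagonal-count ⟩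
  sqNorm n X + u · trace n X + v · + n ∎
  where
  u = - (+ 2 · c)
  v = c · c
  expand : ∀ k x d → (x - k · d) · (x - k · d) ≡ x · x + (- (+ 2 · k)) · (d · x) + (k · k) · (d · d)
  expand = solve-∀
  diagonal-count : ∑[ i < n ] ∑[ j < n ] (δ i j · δ i j) ≡ + n
  diagonal-count = begin
    ∑[ i < n ] ∑[ j < n ] (δ i j · δ i j) ≡⟨ sum-cong n (λ i → trans (sum-δ n i (δ i)) (δ-refl i)) ⟩
    ∑[ i < n ] 1ℤ                         ≡⟨ sum-const n 1ℤ ⟩
    + n · 1ℤ                              ≡⟨ ℤP.*-identityʳ (+ n) ⟩
    + n                                   ∎

-- ‖HᵀH‖² = ‖HHᵀ‖², both being Σₐ Σ_b (Σᵢ Hₐᵢ H_bᵢ)².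
sqNorm-gram : ∀ m n (H : Mat m n) → sqNorm n ((H ᵀ) ⊗ H) ≡ sqNorm m (H ⊗ (H ᵀ))
sqNorm-gram m n H = begin
  ∑[ i < n ] ∑[ j < n ] (((H ᵀ) ⊗ H) i j · ((H ᵀ) ⊗ H) i j)
    ≡⟨ sum-cong n (λ i → sum-cong n (λ j → sum-product m m _ _)) ⟩
  ∑[ i < n ] ∑[ j < n ] ∑[ a < m ] ∑[ b < m ] (H a i · H a j · (H b i · H b j))
    ≡⟨ sum-interchange n m _ ⟩
  ∑[ a < m ] ∑[ b < m ] ∑[ i < n ] ∑[ j < n ] (H a i · H a j · (H b i · H b j))
    ≡⟨ sum-cong m (λ a → sum-cong m (λ b → sum-cong n (λ i → sum-cong n (λ j →
         regroup (H a i) (H a j) (H b i) (H b j))))) ⟩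
  ∑[ a < m ] ∑[ b < m ] ∑[ i < n ] ∑[ j < n ] (H a i · H b i · (H a j · H b j))
    ≡⟨ sum-cong m (λ a → sum-cong m (λ b → sum-product n n _ _)) ⟨
  ∑[ a < m ] ∑[ b < m ] ((H ⊗ (H ᵀ)) a b · (H ⊗ (H ᵀ)) a b) ∎
  where
  regroup : ∀ p q r s → p · q · (r · s) ≡ p · r · (q · s)
  regroup = solve-∀

-- tr(HᵀH) = tr(HHᵀ) = Σₐᵢ Hₐᵢ².
trace-gram : ∀ m n (H : Mat m n) → trace n ((H ᵀ) ⊗ H) ≡ trace m (H ⊗ (H ᵀ))
trace-gram m n H = sum-swap n m (λ i a → H a i · H a i)

-- Hence ‖HᵀH − cI‖² = ‖HHᵀ − cI‖² = 0, so HᵀH = cI.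
gram-transpose : ∀ n (H : Mat n n) c →
  (∀ i j → (H ⊗ (H ᵀ)) i j ≡ c · δ i j) → ∀ i j → ((H ᵀ) ⊗ H) i j ≡ c · δ i j
gram-transpose n H c HHᵀ≡cI i j =
  ℤP.i-j≡0⇒i≡j _ _ (sqNorm-zero n (subScalar c ((H ᵀ) ⊗ H)) deviation-zero i j)
  where
  u = - (+ 2 · c)
  deviation-zero : sqNorm n (subScalar c ((H ᵀ) ⊗ H)) ≡ 0ℤ
  deviation-zero = begin
    sqNorm n (subScalar c ((H ᵀ) ⊗ H))
      ≡⟨ sqNorm-subScalar n c ((H ᵀ) ⊗ H) ⟩
    sqNorm n ((H ᵀ) ⊗ H) + u · trace n ((H ᵀ) ⊗ H) + c · c · + n
      ≡⟨ cong₂ (λ s t → s + u · t + c · c · + n) (sqNorm-gram n n H) (trace-gram n n H) ⟩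
    sqNorm n (H ⊗ (H ᵀ)) + u · trace n (H ⊗ (H ᵀ)) + c · c · + n
      ≡⟨ sqNorm-subScalar n c (H ⊗ (H ᵀ)) ⟨
    sqNorm n (subScalar c (H ⊗ (H ᵀ)))
      ≡⟨ sum-of-zeros n (λ a → sum-of-zeros n (λ b → cong (λ x → x · x) (entry-zero a b))) ⟩
    0ℤ ∎
    where
    entry-zero : ∀ a b → subScalar c (H ⊗ (H ᵀ)) a b ≡ 0ℤ
    entry-zero a b = trans (cong (_- c · δ a b) (HHᵀ≡cI a b)) (ℤP.+-inverseʳ (c · δ a b))

-- 3. Sign rescaling

pm-* : ∀ {a b} → IsPM1 a → IsPM1 b → IsPM1 (a · b)
pm-* (inj₁ refl) (inj₁ refl) = inj₁ refl
pm-* (inj₁ refl) (inj₂ refl) = inj₂ refl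
pm-* (inj₂ refl) (inj₁ refl) = inj₂ refl
pm-* (inj₂ refl) (inj₂ refl) = inj₁ refl

pm-square : ∀ {a} → IsPM1 a → a · a ≡ 1ℤ
pm-square (inj₁ refl) = refl
pm-square (inj₂ refl) = refl

sign-of-bit : ∀ {b} → (b ≡ 0ℤ) ⊎ (b ≡ 1ℤ) → IsPM1 (1ℤ - + 2 · b)
sign-of-bit (inj₁ refl) = inj₁ refl
sign-of-bit (inj₂ refl) = inj₂ refl

pm-δ : ∀ {n} (x : Fin n → ℤ) → (∀ i → IsPM1 (x i)) → ∀ i j → x i · x j · δ i j ≡ δ i j
pm-δ x x± i j = begin
  x i · x j · δ i j      ≡⟨ ℤP.*-assoc (x i) (x j) (δ i j) ⟩
  x i · (x j · δ i j)    ≡⟨ cong (x i ·_) (δ-diag x i j) ⟨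
  x i · (x i · δ i j)    ≡⟨ ℤP.*-assoc (x i) (x i) (δ i j) ⟨
  x i · x i · δ i j      ≡⟨ cong (_· δ i j) (pm-square (x± i)) ⟩
  1ℤ · δ i j             ≡⟨ ℤP.*-identityˡ (δ i j) ⟩
  δ i j                  ∎

rescale : ∀ {N} → (Fin N → ℤ) → (Fin N → ℤ) → Mat N N → Mat N N
rescale x z H i j = x i · z j · H i j

rescale-Hadamard : ∀ N (H : Mat N N) (x z : Fin N → ℤ) →
  (∀ i → IsPM1 (x i)) → (∀ j → IsPM1 (z j)) → IsHadamard N H → IsHadamard N (rescale x z H)
rescale-Hadamard N H x z x± z± (H± , HHᵀ≡NI) = entries , orthogonal
  where
  entries : ∀ i j → IsPM1 (rescale x z H i j)
  entries i j = pm-* (pm-* (x± i) (z± j)) (H± i j)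
  regroup : ∀ p q r s t → p · r · s · (q · r · t) ≡ r · r · (p · q · (s · t))
  regroup = solve-∀
  orthogonal : ∀ i j → (rescale x z H ⊗ (rescale x z H ᵀ)) i j ≡ + N · δ i j
  orthogonal i j = begin
    ∑[ t < N ] (x i · z t · H i t · (x j · z t · H j t))
      ≡⟨ sum-cong N (λ t → regroup (x i) (x j) (z t) (H i t) (H j t)) ⟩
    ∑[ t < N ] (z t · z t · (x i · x j · (H i t · H j t)))
      ≡⟨ sum-cong N (λ t → trans (cong (_· _) (pm-square (z± t))) (ℤP.*-identityˡ _)) ⟩
    ∑[ t < N ] (x i · x j · (H i t · H j t))
      ≡⟨ sum-scale N (x i · x j) _ ⟩
    x i · x j · (H ⊗ (H ᵀ)) i j
      ≡⟨ cong (x i · x j ·_) (HHᵀ≡NI i j) ⟩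
    x i · x j · (+ N · δ i j)
      ≡⟨ ℤP.*-comm (x i · x j) _ ⟩
    + N · δ i j · (x i · x j)
      ≡⟨ ℤP.*-assoc (+ N) (δ i j) _ ⟩
    + N · (δ i j · (x i · x j))
      ≡⟨ cong (+ N ·_) (trans (ℤP.*-comm (δ i j) _) (pm-δ x x± i j)) ⟩
    + N · δ i j ∎

rescale-equivalent : ∀ N (H : Mat N N) (x z : Fin N → ℤ) →
  (∀ i → IsPM1 (x i)) → (∀ j → IsPM1 (z j)) → Equivalent N H (rescale x z H)
rescale-equivalent N H x z x± z± = Perm.id , Perm.id , x , z , x± , z± , λ i j → refl

rescale-column-sum : ∀ N (H : Mat N N) (x z : Fin N → ℤ) s → (∀ j → IsPM1 (z j)) →
  (∀ j → ∑[ i < N ] (x i · H i j) ≡ s · z j) → ∀ j → ∑[ i < N ] rescale x z H i j ≡ s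
rescale-column-sum N H x z s z± signed-sum j = begin
  ∑[ i < N ] (x i · z j · H i j)   ≡⟨ sum-cong N (λ i → regroup (x i) (z j) (H i j)) ⟩
  ∑[ i < N ] (z j · (x i · H i j)) ≡⟨ sum-scale N (z j) _ ⟩
  z j · ∑[ i < N ] (x i · H i j)   ≡⟨ cong (z j ·_) (signed-sum j) ⟩
  z j · (s · z j)                  ≡⟨ swap-front (z j) s (z j) ⟩
  s · (z j · z j)                  ≡⟨ cong (s ·_) (pm-square (z± j)) ⟩
  s · 1ℤ                           ≡⟨ ℤP.*-identityʳ s ⟩
  s                                ∎
  where
  regroup : ∀ p q r → p · q · r ≡ q · (p · r)
  regroup = solve-∀
  swap-front : ∀ p q r → p · (q · r) ≡ q · (p · r)
  swap-front = solve-∀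

regular-from-signed-column-sums : ∀ N s (H : Mat N N) → s * s ≡ N → IsHadamard N H →
  (x z : Fin N → ℤ) → (∀ i → IsPM1 (x i)) → (∀ j → IsPM1 (z j)) →
  (∀ j → ∑[ i < N ] (x i · H i j) ≡ + s · z j) →
  Σ (Mat N N) λ H' → IsHadamard N H' × IsRegular N H' × Equivalent N H H'
regular-from-signed-column-sums N s H s²≡N hadamard x z x± z± signed-sum =
  rescale x z H ,
  rescale-Hadamard N H x z x± z± hadamard ,
  (s , s²≡N , rescale-column-sum N H x z (+ s) z± signed-sum) ,
  rescale-equivalent N H x z x± z±

-- 4. The signed Gram identity of a balanced splitting

below : ℕ → ℕ → ℤ
below m       zero    = 0ℤ
below zero    (suc ℓ) = 1ℤ
below (suc m) (suc ℓ) = below m ℓ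

below-bit : ∀ m ℓ → (below m ℓ ≡ 0ℤ) ⊎ (below m ℓ ≡ 1ℤ)
below-bit m       zero    = inj₁ refl
below-bit zero    (suc ℓ) = inj₂ refl
below-bit (suc m) (suc ℓ) = below-bit m ℓ

sum-below : ∀ N ℓ (ℓ≤N : ℓ ℕ.≤ N) (f : Fin N → ℤ) →
  ∑[ i < N ] (below (toℕ i) ℓ · f i) ≡ ∑[ t < ℓ ] f (inject≤ t ℓ≤N)
sum-below N       zero    ℓ≤N       f = sum-of-zeros N (λ _ → refl)
sum-below (suc N) (suc ℓ) (s≤s ℓ≤N) f =
  cong₂ _+_ (ℤP.*-identityˡ (f zero)) (sum-below N ℓ ℓ≤N (λ i → f (suc i)))

module BalancedSplitting {N ℓ a b} {H : Mat N N} (split : BalancedlySplittable N ℓ a b H) where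

  ℓ≤N : ℓ ℕ.≤ N
  ℓ≤N = proj₁ split

  σ : Permutation′ N
  σ = proj₁ (proj₂ split)

  A : Mat N N
  A = proj₁ (proj₂ (proj₂ split))

  A-adjacency : IsAdj N A
  A-adjacency = proj₁ (proj₂ (proj₂ (proj₂ split)))

  H₁-gram : ∀ k j → ∑[ t < ℓ ] (H (σ ⟨$⟩ʳ inject≤ t ℓ≤N) k · H (σ ⟨$⟩ʳ inject≤ t ℓ≤N) j)
                    ≡ + ℓ · δ k j + a · A k j + b · (1ℤ - A k j - δ k j)
  H₁-gram = proj₂ (proj₂ (proj₂ (proj₂ split)))

  -- 1 on the rows of H₁, 0 on the others.
  inH₁ : Fin N → ℤ
  inH₁ i = below (toℕ (σ ⟨$⟩ˡ i)) ℓ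

  sum-H₁ : ∀ (f : Fin N → ℤ) → ∑[ i < N ] (inH₁ i · f i) ≡ ∑[ t < ℓ ] f (σ ⟨$⟩ʳ inject≤ t ℓ≤N)
  sum-H₁ f = begin
    ∑[ i < N ] (inH₁ i · f i)
      ≡⟨ sum-permute N σ _ ⟩
    ∑[ i < N ] (below (toℕ (σ ⟨$⟩ˡ (σ ⟨$⟩ʳ i))) ℓ · f (σ ⟨$⟩ʳ i))
      ≡⟨ sum-cong N (λ i → cong (λ r → below (toℕ r) ℓ · f (σ ⟨$⟩ʳ i)) (Perm.inverseˡ σ)) ⟩
    ∑[ i < N ] (below (toℕ i) ℓ · f (σ ⟨$⟩ʳ i))
      ≡⟨ sum-below N ℓ ℓ≤N _ ⟩
    ∑[ t < ℓ ] f (σ ⟨$⟩ʳ inject≤ t ℓ≤N) ∎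

  sign : Fin N → ℤ
  sign i = 1ℤ - + 2 · inH₁ i

  sign-pm : ∀ i → IsPM1 (sign i)
  sign-pm i = sign-of-bit (below-bit (toℕ (σ ⟨$⟩ˡ i)) ℓ)

  signed-gram : (∀ i j → ((H ᵀ) ⊗ H) i j ≡ + N · δ i j) → ∀ k j →
    ∑[ i < N ] (sign i · (H i k · H i j))
      ≡ + N · δ k j + (- + 2) · (+ ℓ · δ k j + a · A k j + b · (1ℤ - A k j - δ k j))
  signed-gram HᵀH≡NI k j = begin
    ∑[ i < N ] (sign i · (H i k · H i j))
      ≡⟨ sum-cong N (λ i → expand (inH₁ i) (H i k · H i j)) ⟩
    ∑[ i < N ] (H i k · H i j + (- + 2) · (inH₁ i · (H i k · H i j)))
      ≡⟨ sum-+ N _ _ ⟩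
    ((H ᵀ) ⊗ H) k j + ∑[ i < N ] ((- + 2) · (inH₁ i · (H i k · H i j)))
      ≡⟨ cong (_+_ (((H ᵀ) ⊗ H) k j)) (sum-scale N (- + 2) _) ⟩
    ((H ᵀ) ⊗ H) k j + (- + 2) · ∑[ i < N ] (inH₁ i · (H i k · H i j))
      ≡⟨ cong₂ (λ s t → s + (- + 2) · t) (HᵀH≡NI k j) (sum-H₁ (λ i → H i k · H i j)) ⟩
    + N · δ k j + (- + 2) · ∑[ t < ℓ ] (H (σ ⟨$⟩ʳ inject≤ t ℓ≤N) k · H (σ ⟨$⟩ʳ inject≤ t ℓ≤N) j)
      ≡⟨ cong (λ t → + N · δ k j + (- + 2) · t) (H₁-gram k j) ⟩
    + N · δ k j + (- + 2) · (+ ℓ · δ k j + a · A k j + b · (1ℤ - A k j - δ k j)) ∎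
    where
    expand : ∀ e y → (1ℤ - + 2 · e) · y ≡ y + (- + 2) · (e · y)
    expand = solve-∀

-- 5. The parameters (4n², 2n²−n, n, −n)

-- Truncated subtraction 2n² ∸ n is the integer 2n² − n.
n≤2n² : ∀ n → n ℕ.≤ 2 * n * n
n≤2n² zero      = z≤n
n≤2n² n@(suc _) = ℕP.m≤n*m n (2 * n)

parameters-collapse : ∀ n d α →
  + (4 * n * n) · d + (- + 2) · (+ (2 * n * n ∸ n) · d + + n · α + (- (+ n)) · (1ℤ - α - d))
    ≡ + (2 * n) · (1ℤ - + 2 · α)
parameters-collapse n d α = begin
  + (4 * n * n) · d + (- + 2) · (+ (2 * n * n ∸ n) · d + + n · α + (- (+ n)) · (1ℤ - α - d))
    ≡⟨ cong₂ (λ N ℓ → N · d + (- + 2) · (ℓ · d + + n · α + (- (+ n)) · (1ℤ - α - d))) order split-size ⟩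
  + 4 · + n · + n · d + (- + 2) · ((+ 2 · + n · + n - + n) · d + + n · α + (- (+ n)) · (1ℤ - α - d))
    ≡⟨ collapse (+ n) d α ⟩
  + 2 · + n · (1ℤ - + 2 · α)
    ≡⟨ cong (_· (1ℤ - + 2 · α)) (ℤP.pos-* 2 n) ⟨
  + (2 * n) · (1ℤ - + 2 · α) ∎
  where
  collapse : ∀ m d α → + 4 · m · m · d + (- + 2) · ((+ 2 · m · m - m) · d + m · α + (- m) · (1ℤ - α - d))
                         ≡ + 2 · m · (1ℤ - + 2 · α)
  collapse = solve-∀
  order : + (4 * n * n) ≡ + 4 · + n · + n
  order = trans (ℤP.pos-* (4 * n) n) (cong (_· + n) (ℤP.pos-* 4 n))
  split-size : + (2 * n * n ∸ n) ≡ + 2 · + n · + n - + n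
  split-size = begin
    + (2 * n * n ∸ n)    ≡⟨ ℤP.⊖-≥ (n≤2n² n) ⟨
    (2 * n * n) ⊖ n      ≡⟨ ℤP.m-n≡m⊖n (2 * n * n) n ⟨
    + (2 * n * n) - + n  ≡⟨ cong (_- + n) (trans (ℤP.pos-* (2 * n) n) (cong (_· + n) (ℤP.pos-* 2 n))) ⟩
    + 2 · + n · + n - + n ∎

square-of-2n : ∀ n → 2 * n * (2 * n) ≡ 4 * n * n
square-of-2n = ℕRing.solve-∀

proposition2p14 : (n : ℕ) → .{{_ : NonZero n}} → (H : Mat (4 * n * n) (4 * n * n))
    → IsHadamard (4 * n * n) H
    → BalancedlySplittable (4 * n * n) (2 * n * n ∸ n) (+ n) (- (+ n)) H
    → Σ (Mat (4 * n * n) (4 * n * n)) λ H' →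
    IsHadamard (4 * n * n) H' × IsRegular (4 * n * n) H' × Equivalent (4 * n * n) H H'
proposition2p14 n@(suc _) H hadamard@(H± , HHᵀ≡NI) split =
  regular-from-signed-column-sums N (2 * n) H (square-of-2n n) hadamard x z x± z± column-sums
  where
  open BalancedSplitting {a = + n} {b = - (+ n)} {H = H} split
  N = 4 * n * n
  -- any fixed column works; N ≥ 1 since n ≥ 1
  k : Fin N
  k = zero
  -- Flip the rows of H₁ and normalise column k; flip column j when Aⱼₖ = 1.
  x z : Fin N → ℤ
  x i = sign i · H i k
  z j = 1ℤ - + 2 · A j k
  x± : ∀ i → IsPM1 (x i)
  x± i = pm-* (sign-pm i) (H± i k)
  z± : ∀ j → IsPM1 (z j)
  z± j = sign-of-bit (proj₁ A-adjacency j k)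
  column-sums : ∀ j → ∑[ i < N ] (x i · H i j) ≡ + (2 * n) · z j
  column-sums j = begin
    ∑[ i < N ] (sign i · H i k · H i j)   ≡⟨ sum-cong N (λ i → ℤP.*-assoc (sign i) (H i k) (H i j)) ⟩
    ∑[ i < N ] (sign i · (H i k · H i j)) ≡⟨ signed-gram (gram-transpose N H (+ N) HHᵀ≡NI) k j ⟩
    + N · δ k j + (- + 2) · (+ (2 * n * n ∸ n) · δ k j + + n · A k j + (- (+ n)) · (1ℤ - A k j - δ k j))
                                          ≡⟨ parameters-collapse n (δ k j) (A k j) ⟩
    + (2 * n) · (1ℤ - + 2 · A k j)        ≡⟨ cong (λ α → + (2 * n) · (1ℤ - + 2 · α)) (proj₁ (proj₂ A-adjacency) k j) ⟩
    + (2 * n) · z j                       ∎
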